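{- Given $\rho>0$ and integers $m^*\ge k\ge 3$, there exists $N\in\mathbb N$ such that for every $N$-reduced $k$-graph $\mathcal A$ with index set $[N]$ there exist reals $t_1,\dots,t_k$ and a set $M^*\subseteq[N]$ with $|M^*|=m^*$ such that for every $\mathcal Y=\{y_1<\dots<y_k\}\in[M^*]^k$ and every $\ell\in[k]$, \[ t_\ell\,|\mathcal P_{\mathcal Y\setminus\{y_\ell\}}|\le |\mathcal S^{\rho}_{\mathcal Y\setminus\{y_\ell\}\to y_\ell}|<(t_\ell+\rho)\,|\mathcal P_{\mathcal Y\setminus\{y_\ell\}}|. \]
   Context: For a set $I$, $[I]^j$ denotes its $j$-element subsets. An $m$-reduced $k$-graph $\mathcal A$ with index set $I$ ($|I|=m$) consists of pairwise disjoint finite nonempty vertex classes $\mathcal P_{\mathcal X}$, $\mathcal X\in[I]^{k-1}$, and for each $\mathcal Y\in[I]^k$ a $k$-partite $k$-graph $\mathcal A_{\mathcal Y}$ (constituent) with vertex partition $\{\mathcal P_{\mathcal X}:\mathcal X\in[\mathcal Y]^{k-1}\}$; $\mathcal A$ has vertex set $\bigcup\mathcal P_{\mathcal X}$ and edge set $\bigcup E(\mathcal A_{\mathcal Y})$. For $\mathcal Y=\{y_1<\dots<y_k\}\in[I]^k$, $\ell\in[k]$ and $v\in\mathcal P_{\mathcal Y\setminus\{y_\ell\}}$, the normalized degree is $\deg_{\mathcal Y\to y_\ell}(v)=|\{e\in E(\mathcal A_{\mathcal Y}):v\in e\}|\big/\prod_{j\in[k]\setminus\{\ell\}}|\mathcal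 P_{\mathcal Y\setminus\{y_j\}}|$, and for $\rho>0$, $\mathcal S^\rho_{\mathcal Y\setminus\{y_\ell\}\to y_\ell}=\{v\in\mathcal P_{\mathcal Y\setminus\{y_\ell\}}:\deg_{\mathcal Y\to y_\ell}(v)\ge\rho\}$.
   Formalization: The parameter ρ ranges over the positive rationals, and the reals $t_1,\dots,t_k$ are taken in the rationals. -}

module Defs where

open import Data.Nat using (ℕ; zero; suc; pred)
open import Data.Nat as ℕ using ()
open import Data.Bool using (Bool; true; false; _∧_; if_then_else_)
open import Data.Fin using (Fin; zero; suc)
open import Data.Fin as Fin using ()
open import Data.Fin.Properties using () renaming (_≟_ to _≟ᶠ_)
open import Data.List using (List; map; allFin)
open import Data.Nat.ListAction using (sum; product)
open import Data.Vec using (Vec; _∷_; removeAt; lookup)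
open import Data.Integer using (+_)
open import Data.Rational using (ℚ; 0ℚ; _/_; _≤_)
open import Data.Rational.Properties using (_≤?_)
open import Relation.Nullary.Decidable using (⌊_⌋)

-- A k-element subset of [N] = Fin N is represented by the strictly increasing
-- vector (y_1 < ... < y_k) of its elements.
Increasing : ∀ {N m} → Vec (Fin N) m → Set
Increasing {m = m} Y = (i j : Fin m) → i Fin.< j → lookup Y i Fin.< lookup Y j

drop1 : ∀ {A : Set} {k} → Vec A k → Fin k → Vec A (pred k)
drop1 (x ∷ xs) i = removeAt (x ∷ xs) i

-- Vertex class P_X (X a (k-1)-subset)
-- is modelled as Fin (size X), so classes are finite and (being tagged by X)
-- pairwise disjoint.  An edge of the constituent A_Y (k-partite with parts
-- P_{Y∖{y_j}}, j ∈ [k]) picks exactly one vertex from each part, i.e. it is a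
-- tuple (j : Fin k) → P_{Y∖{y_j}}; edge Y f says whether it is an edge.
record ReducedGraph (N k : ℕ) : Set where
  field
    size     : Vec (Fin N) (pred k) → ℕ
    size-pos : (X : Vec (Fin N) (pred k)) → Increasing X → 1 ℕ.≤ size X
    edge     : (Y : Vec (Fin N) k) → ((j : Fin k) → Fin (size (drop1 Y j))) → Bool

countFin : (n : ℕ) → (Fin n → Bool) → ℕ
countFin n P = sum (map (λ i → if P i then 1 else 0) (allFin n))

prodFin : (n : ℕ) → (Fin n → ℕ) → ℕ
prodFin n f = product (map f (allFin n))

countTuples : (k : ℕ) (s : Fin k → ℕ) → (((j : Fin k) → Fin (s j)) → Bool) → ℕ
countTuples zero    s P = if P (λ ()) then 1 else 0
countTuples (suc k) s P =
  sum (map (λ x → countTuples k (λ j → s (suc j))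
                    (λ f → P (λ { zero → x ; (suc j) → f j })))
           (allFin (s zero)))

-- c / d as a rational (d = 0 does not occur for genuine index sets)
ratio : ℕ → ℕ → ℚ
ratio c zero    = 0ℚ
ratio c (suc d) = (+ c) / suc d

module _ {N k : ℕ} (A : ReducedGraph N k) where
  open ReducedGraph A

  partSize : Vec (Fin N) k → Fin k → ℕ
  partSize Y ℓ = size (drop1 Y ℓ)

  edgeDeg : (Y : Vec (Fin N) k) (ℓ : Fin k) → Fin (partSize Y ℓ) → ℕ
  edgeDeg Y ℓ v = countTuples k (partSize Y)
                    (λ f → edge Y f ∧ ⌊ f ℓ ≟ᶠ v ⌋)

  deg : (Y : Vec (Fin N) k) (ℓ : Fin k) → Fin (partSize Y ℓ) → ℚ
  deg Y ℓ v = ratio (edgeDeg Y ℓ v)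
                (prodFin k (λ j → if ⌊ j ≟ᶠ ℓ ⌋ then 1 else partSize Y j))

  bigDegCount : ℚ → (Y : Vec (Fin N) k) → Fin k → ℕ
  bigDegCount ρ Y ℓ = countFin (partSize Y ℓ) (λ v → ⌊ ρ ≤? deg Y ℓ v ⌋)

{-# OPTIONS --safe #-}
module Submission where

-- For a k-set Y and ℓ ∈ [k], the fraction |S^ρ|/|P| lies in [0,1], so it falls into one of the
-- intervals [jρ, (j+1)ρ) with j ≤ J, where (J+1)ρ > 1.  The interval index, one for each ℓ,
-- gives k colourings of the k-subsets of [N] with J+1 colours each, and the hypergraph Ramsey
-- theorem (for several colourings at once) yields an m*-set M on which all of them are
-- constant; then t_ℓ = j_ℓ ρ.  Ramsey's theorem is proved by the Erdős–Rado argument: greedily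
-- build a sequence in which the colour of a (k+1)-set depends only on its first element, then
-- apply the pigeonhole principle to these first-element colours.

open import Defs
open import Data.Nat using (ℕ; _≤_)
open import Data.Fin using (Fin)
open import Data.Fin.Subset using (Subset; _∈_; ∣_∣)
open import Data.Vec using (Vec; lookup)
open import Data.Product using (Σ; _×_)
open import Data.Integer using (+_)
open import Data.Rational using (ℚ; 0ℚ; _/_; _+_; _*_) renaming (_≤_ to _≤ℚ_; _<_ to _<ℚ_)
open import Relation.Binary.PropositionalEquality using (_≡_)

open import Data.Bool using (Bool; true; false; if_then_else_)
open import Data.Fin as Fin using (zero; suc; punchIn)
import Data.Fin.Properties as Fin
open import Data.Integer as ℤ using (+≤+; +<+)
import Data.Integer.Properties as ℤ
open import Data.Integer.Tactic.RingSolver using (solve-∀)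
open import Data.List as List using (List; []; _∷_; length; map; filter)
open import Data.List.Membership.Propositional using () renaming (_∈_ to _∈ˡ_)
open import Data.List.Properties using (length-map; length-take; length-tabulate)
open import Data.List.Relation.Binary.Sublist.Propositional using (_⊆_; []; _∷_; _∷ʳ_; ⊆-trans; minimum)
open import Data.List.Relation.Binary.Sublist.Propositional.Properties using (All-resp-⊆; filter-⊆; take-⊆; map⁺)
open import Data.List.Relation.Unary.All using (All; []; _∷_)
import Data.List.Relation.Unary.All as All
open import Data.List.Relation.Unary.All.Properties using (all-filter; filter⁺)
open import Data.List.Relation.Unary.AllPairs using (AllPairs; []; _∷_)
open import Data.List.Relation.Unary.Any using (here; there)
open import Data.Nat as ℕ using (zero; suc; _<_; _≟_; _≤?_; z≤n; s≤s; s≤s⁻¹)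
open import Data.Nat.Coprimality using (Coprime)
open import Data.Nat.ListAction using (sum)
open import Data.Nat.Properties
  using (≤∧≢⇒<; ≰⇒>; <⇒≤; n<1+n; m<n⇒m<1+n; m≤n⇒m⊓n≡m; m≤n⇒m≤1+n; +-suc; +-cancelˡ-<; +-monoˡ-≤;
         <-≤-trans; ≤-reflexive; ≤-trans; m≤m*n)
open import Data.Product using (∃-syntax; _,_; proj₁; proj₂)
open import Data.Rational using (mkℚ; 1ℚ; toℚᵘ; positive)
import Data.Rational.Properties as ℚ
open import Data.Rational.Properties using () renaming (_<?_ to _<ℚ?_)
open import Data.Rational.Unnormalised as ℚᵘ using (mkℚᵘ; *≡*; *≤*; *<*)
import Data.Rational.Unnormalised.Properties as ℚᵘ
open import Data.Vec using ([]; _∷_; toList; allFin; removeAt; here; there)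
open import Data.Vec.Properties using (lookup-allFin; length-toList; removeAt-punchOut)
open import Data.Vec.Relation.Unary.All.Properties using (toList⁺; lookup⁻)
open import Function using (_∘_)
open import Relation.Binary.Core using (Rel)
open import Relation.Binary.Structures using (IsStrictPartialOrder)
open import Relation.Binary.PropositionalEquality using (_≢_; refl; sym; trans; cong; subst; subst₂)
open import Relation.Nullary using (yes; no; contradiction)
open import Relation.Unary using (Decidable)
open import Relation.Unary.Properties using (∁?)

module _ {A : Set} where

  record SublistOfLength (m : ℕ) (L : List A) (P : List A → Set) : Set where
    constructor sublistOfLength
    field
      {sublist}      : List A
      sublist⊆       : sublist ⊆ L
      length-sublist : length sublist ≡ m
      property       : P sublist

  takeSublist : ∀ {m L} {P : List A → Set} → m ≤ length L → (∀ {L′} → L′ ⊆ L → P L′) →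
                SublistOfLength m L P
  takeSublist {m} {L} m≤|L| P-⊆ =
    sublistOfLength (take-⊆ m L) (trans (length-take m L) (m≤n⇒m⊓n≡m m≤|L|)) (P-⊆ (take-⊆ m L))

  sublistOfLength-⊆ : ∀ {m L₁ L₂ P} → L₁ ⊆ L₂ → SublistOfLength m L₁ P → SublistOfLength m L₂ P
  sublistOfLength-⊆ L₁⊆L₂ (sublistOfLength L′⊆L₁ |L′| p) = sublistOfLength (⊆-trans L′⊆L₁ L₁⊆L₂) |L′| p

  mapProperty : ∀ {m L} {P Q : List A → Set} → (∀ {L′} → P L′ → Q L′) →
                SublistOfLength m L P → SublistOfLength m L Q
  mapProperty f (sublistOfLength L′⊆L |L′| p) = sublistOfLength L′⊆L |L′| (f p)

  length-filter+filter-∁ : {P : A → Set} (P? : Decidable P) (xs : List A) →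
                           length (filter P? xs) ℕ.+ length (filter (∁? P?) xs) ≡ length xs
  length-filter+filter-∁ P? []       = refl
  length-filter+filter-∁ P? (x ∷ xs) with P? x
  ... | yes _ = cong suc (length-filter+filter-∁ P? xs)
  ... | no  _ = trans (+-suc _ _) (cong suc (length-filter+filter-∁ P? xs))

  pigeonhole : (f : A → ℕ) (c m : ℕ) {L : List A} → All (λ x → f x < c) L → c ℕ.* m < length L →
               SublistOfLength m L (λ L′ → ∃[ col ] col < c × All (λ x → f x ≡ col) L′)
  pigeonhole f zero    m (() ∷ _) _
  pigeonhole f (suc c) m {L} f<c+1 c+1*m<|L| with m ≤? length (filter (λ x → f x ≟ c) L)
  ... | yes m≤|L₀| = sublistOfLength-⊆ (filter-⊆ _ L)
                       (takeSublist m≤|L₀| λ τ → c , n<1+n c , All-resp-⊆ τ (all-filter _ L))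
  ... | no  m≰|L₀| = sublistOfLength-⊆ (filter-⊆ _ L)
                       (mapProperty (λ (col , col<c , same) → col , m<n⇒m<1+n col<c , same)
                         (pigeonhole f c m f<c c*m<|L₁|))
    where
    hasColour? = λ x → f x ≟ c
    L₁ = filter (∁? hasColour?) L
    f<c : All (λ x → f x < c) L₁
    f<c = All.zipWith (λ (lt , ≢c) → ≤∧≢⇒< (s≤s⁻¹ lt) ≢c) (filter⁺ _ f<c+1 , all-filter _ L)
    c*m<|L₁| : c ℕ.* m < length L₁
    c*m<|L₁| = +-cancelˡ-< m _ _ (<-≤-trans c+1*m<|L|
      (≤-trans (≤-reflexive (sym (length-filter+filter-∁ hasColour? L))) (+-monoˡ-≤ _ (<⇒≤ (≰⇒> m≰|L₀|)))))

  Monochromatic : ∀ {k} → (Vec A k → ℕ) → ℕ → List A → Set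
  Monochromatic χ col L = ∀ Z → toList Z ⊆ L → χ Z ≡ col

  monochromatic-⊆ : ∀ {k} {χ : Vec A k → ℕ} {col L₁ L₂} → L₁ ⊆ L₂ →
                    Monochromatic χ col L₂ → Monochromatic χ col L₁
  monochromatic-⊆ L₁⊆L₂ mono Z Z⊆L₁ = mono Z (⊆-trans Z⊆L₁ L₁⊆L₂)

  data PreHomogeneous {k} (χ : Vec A (suc k) → ℕ) (c : ℕ) : List (A × ℕ) → Set where
    []  : PreHomogeneous χ c []
    _∷_ : ∀ {a col S} → col < c × Monochromatic (χ ∘ (a ∷_)) col (map proj₁ S) →
          PreHomogeneous χ c S → PreHomogeneous χ c ((a , col) ∷ S)

  module _ {k} {χ : Vec A (suc k) → ℕ} {c : ℕ} where

    colours< : ∀ {S} → PreHomogeneous χ c S → All (λ (_ , col) → col < c) S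
    colours< []                = []
    colours< ((col<c , _) ∷ S) = col<c ∷ colours< S

    preHomogeneous-⊆ : ∀ {S₁ S₂} → S₁ ⊆ S₂ → PreHomogeneous χ c S₂ → PreHomogeneous χ c S₁
    preHomogeneous-⊆ []         []                   = []
    preHomogeneous-⊆ (_ ∷ʳ τ)   (_ ∷ S)              = preHomogeneous-⊆ τ S
    preHomogeneous-⊆ (refl ∷ τ) ((col<c , mono) ∷ S) =
      (col<c , monochromatic-⊆ (map⁺ proj₁ τ) mono) ∷ preHomogeneous-⊆ τ S

    preHomogeneous⇒monochromatic : ∀ {S col} → PreHomogeneous χ c S →
                                   All (λ (_ , col′) → col′ ≡ col) S → Monochromatic χ col (map proj₁ S)
    preHomogeneous⇒monochromatic (_ ∷ S) (_ ∷ same) (z ∷ Z) (_ ∷ʳ τ) =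
      preHomogeneous⇒monochromatic S same (z ∷ Z) τ
    preHomogeneous⇒monochromatic ((_ , mono) ∷ _) (col′≡col ∷ _) (_ ∷ Z) (refl ∷ τ) =
      trans (mono Z τ) col′≡col

RamseyBound : (k c m n : ℕ) → Set₁
RamseyBound k c m n = ∀ {A : Set} (χ : Vec A k → ℕ) → (∀ Z → χ Z < c) →
  (L : List A) → n ≤ length L →
  SublistOfLength m L (λ L′ → ∃[ col ] col < c × Monochromatic χ col L′)

ramsey : (k c m : ℕ) → Σ ℕ (RamseyBound k c m)
ramsey zero    c m = m , λ χ χ<c L m≤|L| → takeSublist m≤|L| λ _ → χ [] , χ<c [] , λ { [] _ → refl }
ramsey (suc k) c m = sequenceBound (suc (c ℕ.* m)) , bound
  where
  sequenceBound : ℕ → ℕ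
  sequenceBound zero    = zero
  sequenceBound (suc T) = suc (proj₁ (ramsey k c (sequenceBound T)))

  preHomogeneousSequence : ∀ {A : Set} (χ : Vec A (suc k) → ℕ) → (∀ Z → χ Z < c) → (T : ℕ) (L : List A) →
    sequenceBound T ≤ length L →
    Σ (List (A × ℕ)) λ S → map proj₁ S ⊆ L × length S ≡ T × PreHomogeneous χ c S
  preHomogeneousSequence χ χ<c zero    L       _ = [] , minimum L , refl , []
  preHomogeneousSequence χ χ<c (suc T) (a ∷ L) (s≤s bound≤|L|)
    with proj₂ (ramsey k c (sequenceBound T)) (χ ∘ (a ∷_)) (χ<c ∘ (a ∷_)) L bound≤|L|
  ... | sublistOfLength L′⊆L |L′| (col , col<c , mono)
    with preHomogeneousSequence χ χ<c T _ (≤-reflexive (sym |L′|))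
  ... | S , S⊆L′ , |S| , S-pre =
    (a , col) ∷ S , refl ∷ ⊆-trans S⊆L′ L′⊆L , cong suc |S| , (col<c , monochromatic-⊆ S⊆L′ mono) ∷ S-pre

  bound : RamseyBound (suc k) c m (sequenceBound (suc (c ℕ.* m)))
  bound χ χ<c L bound≤|L| with preHomogeneousSequence χ χ<c (suc (c ℕ.* m)) L bound≤|L|
  ... | S , S⊆L , |S| , S-pre with pigeonhole proj₂ c m (colours< S-pre) (≤-reflexive (sym |S|))
  ... | sublistOfLength {S′} S′⊆S |S′| (col , col<c , same) =
    sublistOfLength (⊆-trans (map⁺ proj₁ S′⊆S) S⊆L) (trans (length-map proj₁ S′) |S′|)
      (col , col<c , preHomogeneous⇒monochromatic (preHomogeneous-⊆ S′⊆S S-pre) same)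

SimultaneousRamseyBound : (k r c m n : ℕ) → Set₁
SimultaneousRamseyBound k r c m n = ∀ {A : Set} (χ : Fin r → Vec A k → ℕ) → (∀ i Z → χ i Z < c) →
  (L : List A) → n ≤ length L →
  SublistOfLength m L (λ L′ → Σ (Fin r → ℕ) λ col → ∀ i → Monochromatic (χ i) (col i) L′)

simultaneousRamsey : (k r c m : ℕ) → Σ ℕ (SimultaneousRamseyBound k r c m)
simultaneousRamsey k zero    c m = m , λ χ _ L m≤|L| → takeSublist m≤|L| λ _ → (λ ()) , λ ()
simultaneousRamsey k (suc r) c m = proj₁ (ramsey k c n) , bound
  where
  n = proj₁ (simultaneousRamsey k r c m)
  bound : SimultaneousRamseyBound k (suc r) c m (proj₁ (ramsey k c n))
  bound χ χ<c L bound≤|L| with proj₂ (ramsey k c n) (χ zero) (χ<c zero) L bound≤|L|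
  ... | sublistOfLength L₁⊆L |L₁| (col₀ , _ , mono₀)
    with proj₂ (simultaneousRamsey k r c m) (χ ∘ suc) (χ<c ∘ suc) _ (≤-reflexive (sym |L₁|))
  ... | sublistOfLength L₂⊆L₁ |L₂| (cols , monos) =
    sublistOfLength (⊆-trans L₂⊆L₁ L₁⊆L) |L₂|
      (col , λ { zero → monochromatic-⊆ L₂⊆L₁ mono₀ ; (suc i) → monos i })
    where
    col : Fin (suc r) → ℕ
    col zero    = col₀
    col (suc i) = cols i

module _ {A : Set} where

  AllPairs-resp-⊆ : ∀ {ℓ} {R : Rel A ℓ} {xs ys} → xs ⊆ ys → AllPairs R ys → AllPairs R xs
  AllPairs-resp-⊆ []         []           = []
  AllPairs-resp-⊆ (_ ∷ʳ τ)   (_ ∷ ys↑)    = AllPairs-resp-⊆ τ ys↑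
  AllPairs-resp-⊆ (refl ∷ τ) (y<ys ∷ ys↑) = All-resp-⊆ τ y<ys ∷ AllPairs-resp-⊆ τ ys↑

  ∈-tail : ∀ {x y} {ys : List A} → x ≢ y → x ∈ˡ y ∷ ys → x ∈ˡ ys
  ∈-tail x≢y (here x≡y)   = contradiction x≡y x≢y
  ∈-tail _   (there x∈ys) = x∈ys

  module _ {ℓ} {_≺_ : Rel A ℓ} (≺-isStrictPartialOrder : IsStrictPartialOrder _≡_ _≺_) where
    open IsStrictPartialOrder ≺-isStrictPartialOrder using (irrefl) renaming (trans to ≺-trans)

    sorted-∈⇒⊆ : ∀ {xs ys} → AllPairs _≺_ xs → AllPairs _≺_ ys → All (_∈ˡ ys) xs → xs ⊆ ys
    sorted-∈⇒⊆ {[]}    {ys}    _            _            _                  = minimum ys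
    sorted-∈⇒⊆ {x ∷ _} {_ ∷ _} (x≺xs ∷ xs↑) (_ ∷ ys↑)    (here refl ∷ xs∈)  =
      refl ∷ sorted-∈⇒⊆ xs↑ ys↑
        (All.zipWith (λ (x≺x′ , x′∈) → ∈-tail (λ x′≡x → irrefl (sym x′≡x) x≺x′) x′∈) (x≺xs , xs∈))
    sorted-∈⇒⊆ {x ∷ _} {y ∷ _} (x≺xs ∷ xs↑) (y≺ys ∷ ys↑) (there x∈ys ∷ xs∈) =
      y ∷ʳ sorted-∈⇒⊆ (x≺xs ∷ xs↑) ys↑
        (x∈ys ∷ All.zipWith (λ (x≺x′ , x′∈) → ∈-tail (λ x′≡y → irrefl (sym x′≡y) (≺-trans y≺x x≺x′)) x′∈)
                            (x≺xs , xs∈))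
      where y≺x = All.lookup y≺ys x∈ys

  selection : ∀ {n} {L : List A} (xs : Vec A n) → L ⊆ toList xs → Subset n
  selection []       []       = []
  selection (_ ∷ xs) (_ ∷ʳ τ) = false ∷ selection xs τ
  selection (_ ∷ xs) (_ ∷ τ)  = true ∷ selection xs τ

  ∣selection∣ : ∀ {n} {L : List A} (xs : Vec A n) (τ : L ⊆ toList xs) → ∣ selection xs τ ∣ ≡ length L
  ∣selection∣ []       []         = refl
  ∣selection∣ (_ ∷ xs) (_ ∷ʳ τ)   = ∣selection∣ xs τ
  ∣selection∣ (_ ∷ xs) (refl ∷ τ) = cong suc (∣selection∣ xs τ)

  ∈-selection : ∀ {n} {L : List A} (xs : Vec A n) (τ : L ⊆ toList xs) {i} →
                i ∈ selection xs τ → lookup xs i ∈ˡ L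
  ∈-selection (_ ∷ xs) (_ ∷ʳ τ)   (there i∈) = ∈-selection xs τ i∈
  ∈-selection (_ ∷ xs) (refl ∷ τ) here       = here refl
  ∈-selection (_ ∷ xs) (refl ∷ τ) (there i∈) = there (∈-selection xs τ i∈)

increasing⇒sorted : ∀ {N k} {Y : Vec (Fin N) k} → Increasing Y → AllPairs Fin._<_ (toList Y)
increasing⇒sorted {Y = []}    _  = []
increasing⇒sorted {Y = _ ∷ _} Y↑ =
  toList⁺ (lookup⁻ λ i → Y↑ zero (suc i) (s≤s z≤n)) ∷
  increasing⇒sorted λ i j i<j → Y↑ (suc i) (suc j) (s≤s i<j)

allFin-increasing : ∀ N → Increasing (allFin N)
allFin-increasing N i j = subst₂ Fin._<_ (sym (lookup-allFin i)) (sym (lookup-allFin j))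

increasing-⊆ : ∀ {N k} {L : List (Fin N)} (τ : L ⊆ toList (allFin N)) {Y : Vec (Fin N) k} → Increasing Y →
               (∀ i → lookup Y i ∈ selection (allFin N) τ) → toList Y ⊆ L
increasing-⊆ {N} τ Y↑ Y∈ = sorted-∈⇒⊆ Fin.<-isStrictPartialOrder (increasing⇒sorted Y↑)
  (AllPairs-resp-⊆ τ (increasing⇒sorted (allFin-increasing N)))
  (toList⁺ (lookup⁻ λ i → subst (_∈ˡ _) (lookup-allFin _) (∈-selection (allFin N) τ (Y∈ i))))

infixl 7 _·_

_·_ : ℕ → ℚ → ℚ
zero  · ρ = 0ℚ
suc j · ρ = j · ρ + ρ

toℚᵘ-· : ∀ j n d .(c : Coprime ℤ.∣ n ∣ (suc d)) → toℚᵘ (j · mkℚ n d c) ℚᵘ.≃ mkℚᵘ (+ j ℤ.* n) d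
toℚᵘ-· zero    n d c = *≡* refl
toℚᵘ-· (suc j) n d c = ℚᵘ.≃-trans (ℚ.toℚᵘ-homo-+ (j · ρ) ρ)
  (ℚᵘ.≃-trans (ℚᵘ.+-congˡ (toℚᵘ ρ) (toℚᵘ-· j n d c)) (*≡* (cross-multiplied (+ j) n (+ suc d))))
  where
  ρ = mkℚ n d c
  cross-multiplied : ∀ j n D → (j ℤ.* n ℤ.* D ℤ.+ n ℤ.* D) ℤ.* D ≡ ((ℤ.1ℤ ℤ.+ j) ℤ.* n) ℤ.* (D ℤ.* D)
  cross-multiplied = solve-∀

archimedean : ∀ ρ → 0ℚ <ℚ ρ → ∃[ J ] 1ℚ <ℚ suc J · ρ
archimedean (mkℚ (+ suc n) d c) _ =
  suc d , ℚ.toℚᵘ-cancel-< (ℚᵘ.<-respʳ-≃ (ℚᵘ.≃-sym (toℚᵘ-· (suc (suc d)) (+ suc n) d c)) (*<* 1·D<J·n·1))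
  where
  1·D<J·n·1 : ℤ.1ℤ ℤ.* + suc d ℤ.< (+ suc (suc d) ℤ.* + suc n) ℤ.* ℤ.1ℤ
  1·D<J·n·1 = subst₂ ℤ._<_ (sym (ℤ.*-identityˡ _))
    (sym (trans (ℤ.*-identityʳ _) (sym (ℤ.pos-* (suc (suc d)) (suc n)))))
    (+<+ (<-≤-trans (n<1+n (suc d)) (m≤m*n (suc (suc d)) (suc n))))
archimedean (mkℚ (+ zero)    _ _) 0<ρ with () ← positive 0<ρ
archimedean (mkℚ ℤ.-[1+ _ ] _ _) 0<ρ with () ← positive 0<ρ

-- + n / 1 is definitionally fromℚᵘ (mkℚᵘ (+ n) 0).
ℕ/1-mono-≤ : ∀ {m n} → m ≤ n → + m / 1 ≤ℚ + n / 1
ℕ/1-mono-≤ {m} {n} m≤n = ℚ.toℚᵘ-cancel-≤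
  (ℚᵘ.≤-respˡ-≃ (ℚᵘ.≃-sym (ℚ.toℚᵘ-fromℚᵘ (mkℚᵘ (+ m) 0)))
  (ℚᵘ.≤-respʳ-≃ (ℚᵘ.≃-sym (ℚ.toℚᵘ-fromℚᵘ (mkℚᵘ (+ n) 0)))
  (*≤* (ℤ.*-monoʳ-≤-nonNeg ℤ.1ℤ (+≤+ m≤n)))))

bracket : (ℕ → ℚ) → ℚ → ℕ → ℕ
bracket f x zero    = zero
bracket f x (suc n) with x <ℚ? f 1
... | yes _ = zero
... | no  _ = suc (bracket (f ∘ suc) x n)

bracket≤ : ∀ (f : ℕ → ℚ) x n → bracket f x n ≤ n
bracket≤ f x zero    = z≤n
bracket≤ f x (suc n) with x <ℚ? f 1
... | yes _ = z≤n
... | no  _ = s≤s (bracket≤ (f ∘ suc) x n)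

bracket-lower : ∀ (f : ℕ → ℚ) x n → f 0 ≤ℚ x → f (bracket f x n) ≤ℚ x
bracket-lower f x zero    f0≤x = f0≤x
bracket-lower f x (suc n) f0≤x with x <ℚ? f 1
... | yes _    = f0≤x
... | no  x≮f1 = bracket-lower (f ∘ suc) x n (ℚ.≮⇒≥ x≮f1)

bracket-upper : ∀ (f : ℕ → ℚ) x n → x <ℚ f (suc n) → x <ℚ f (suc (bracket f x n))
bracket-upper f x zero    x<f1 = x<f1
bracket-upper f x (suc n) x<f  with x <ℚ? f 1
... | yes x<f1 = x<f1
... | no  _    = bracket-upper (f ∘ suc) x n x<f

InBand : ℚ → ℚ → ℕ → ℕ → Set
InBand ρ t s p = t * (+ p / 1) ≤ℚ + s / 1 × + s / 1 <ℚ (t + ρ) * (+ p / 1)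

gridIndex : ℚ → ℕ → ℕ → ℕ → ℕ
gridIndex ρ J s p = bracket (λ j → j · ρ * (+ p / 1)) (+ s / 1) J

gridIndex-inBand : ∀ ρ J {s p} → 1ℚ <ℚ suc J · ρ → s ≤ p → 1 ≤ p → InBand ρ (gridIndex ρ J s p · ρ) s p
gridIndex-inBand ρ J {s} {p@(suc _)} 1<J+1·ρ s≤p _ =
  bracket-lower f (+ s / 1) J
    (subst (_≤ℚ + s / 1) (sym (ℚ.*-zeroˡ (+ p / 1))) (ℚ.nonNegative⁻¹ _ {{ℚ.normalize-nonNeg s 1}})) ,
  bracket-upper f (+ s / 1) J (ℚ.≤-<-trans (ℕ/1-mono-≤ s≤p)
    (subst (_<ℚ suc J · ρ * (+ p / 1)) (ℚ.*-identityˡ _)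
           (ℚ.*-monoˡ-<-pos (+ p / 1) {{ℚ.normalize-pos p 1}} 1<J+1·ρ)))
  where
  f : ℕ → ℚ
  f j = j · ρ * (+ p / 1)

sum-indicator≤length : ∀ {B : Set} (P : B → Bool) (xs : List B) →
                       sum (map (λ x → if P x then 1 else 0) xs) ≤ length xs
sum-indicator≤length P []       = z≤n
sum-indicator≤length P (x ∷ xs) with P x
... | true  = s≤s (sum-indicator≤length P xs)
... | false = m≤n⇒m≤1+n (sum-indicator≤length P xs)

countFin≤ : ∀ n P → countFin n P ≤ n
countFin≤ n P = ≤-trans (sum-indicator≤length P (List.allFin n)) (≤-reflexive (length-tabulate _))

lookup-removeAt : ∀ {A : Set} {n} (xs : Vec A (suc n)) i j → lookup (removeAt xs i) j ≡ lookup xs (punchIn i j)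
lookup-removeAt xs i j = trans (cong (lookup (removeAt xs i)) (sym (Fin.punchOut-punchIn i)))
                               (removeAt-punchOut xs (Fin.punchInᵢ≢i i j ∘ sym))

punchIn-mono-< : ∀ {n} i (j k : Fin n) → j Fin.< k → punchIn i j Fin.< punchIn i k
punchIn-mono-< i j k j<k =
  Fin.≤∧≢⇒< (Fin.punchIn-mono-≤ i j k (<⇒≤ j<k)) (λ eq → Fin.<-irrefl (Fin.punchIn-injective i j k eq) j<k)

drop1-increasing : ∀ {N k} (Y : Vec (Fin N) k) ℓ → Increasing Y → Increasing (drop1 Y ℓ)
drop1-increasing Y@(_ ∷ _) ℓ Y↑ i j i<j = subst₂ Fin._<_ (sym (lookup-removeAt Y ℓ i)) (sym (lookup-removeAt Y ℓ j))
                                                (Y↑ _ _ (punchIn-mono-< ℓ i j i<j))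

degreeGridIndex : ∀ {N k} → ℚ → ℕ → ReducedGraph N k → Fin k → Vec (Fin N) k → ℕ
degreeGridIndex ρ J A ℓ Y = gridIndex ρ J (bigDegCount A ρ Y ℓ) (partSize A Y ℓ)

degreeGridIndex-inBand : ∀ {N k} ρ J → 1ℚ <ℚ suc J · ρ → (A : ReducedGraph N k) {Y : Vec (Fin N) k} →
  Increasing Y → ∀ ℓ → InBand ρ (degreeGridIndex ρ J A ℓ Y · ρ) (bigDegCount A ρ Y ℓ) (partSize A Y ℓ)
degreeGridIndex-inBand ρ J 1<J+1·ρ A {Y} Y↑ ℓ =
  gridIndex-inBand ρ J 1<J+1·ρ (countFin≤ _ _) (ReducedGraph.size-pos A (drop1 Y ℓ) (drop1-increasing Y ℓ Y↑))

BandedSubset : ∀ {N k} → ℚ → ℕ → ReducedGraph N k → Set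
BandedSubset {N} {k} ρ mStar A = Σ (Fin k → ℚ) λ t → Σ (Subset N) λ M → ∣ M ∣ ≡ mStar ×
  ((Y : Vec (Fin N) k) → Increasing Y → ((i : Fin k) → lookup Y i ∈ M) →
    (ℓ : Fin k) → InBand ρ (t ℓ) (bigDegCount A ρ Y ℓ) (partSize A Y ℓ))

bandedSubset : ∀ {N k mStar} ρ J → 1ℚ <ℚ suc J · ρ → SimultaneousRamseyBound k k (suc J) mStar N →
               (A : ReducedGraph N k) → BandedSubset ρ mStar A
bandedSubset {N} {k} {mStar} ρ J 1<J+1·ρ ramseyN A =
  banded (ramseyN χ (λ _ _ → s≤s (bracket≤ _ _ J)) (toList (allFin N))
                  (≤-reflexive (sym (length-toList (allFin N)))))
  where
  χ : Fin k → Vec (Fin N) k → ℕ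
  χ = degreeGridIndex ρ J A
  banded : SublistOfLength mStar (toList (allFin N))
             (λ L′ → Σ (Fin k → ℕ) λ col → ∀ ℓ → Monochromatic (χ ℓ) (col ℓ) L′) →
           BandedSubset ρ mStar A
  banded (sublistOfLength τ |L| (col , mono)) =
    (λ ℓ → col ℓ · ρ) , selection (allFin N) τ , trans (∣selection∣ (allFin N) τ) |L| ,
    λ Y Y↑ Y∈M ℓ → subst (λ j → InBand ρ (j · ρ) (bigDegCount A ρ Y ℓ) (partSize A Y ℓ))
                         (mono ℓ Y (increasing-⊆ τ Y↑ Y∈M)) (degreeGridIndex-inBand ρ J 1<J+1·ρ A Y↑ ℓ)

lemma5p3 : (ρ : ℚ) → 0ℚ <ℚ ρ → (k mStar : ℕ) → 3 ≤ k → k ≤ mStar →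
    Σ ℕ λ N → (A : ReducedGraph N k) →
      Σ (Fin k → ℚ) λ t → Σ (Subset N) λ M →
        ∣ M ∣ ≡ mStar ×
        ((Y : Vec (Fin N) k) → Increasing Y → ((i : Fin k) → lookup Y i ∈ M) →
          (ℓ : Fin k) →
            (t ℓ * ((+ partSize A Y ℓ) / 1) ≤ℚ (+ bigDegCount A ρ Y ℓ) / 1)
            × ((+ bigDegCount A ρ Y ℓ) / 1 <ℚ (t ℓ + ρ) * ((+ partSize A Y ℓ) / 1)))
lemma5p3 ρ 0<ρ k mStar _ _ =
  let J , 1<J+1·ρ = archimedean ρ 0<ρ
      N , ramseyN = simultaneousRamsey k k (suc J) mStar
  in N , bandedSubset ρ J 1<J+1·ρ ramseyN
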